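{- Let $a$ be a weak composition. Then $\mathrm{frev}(\mathrm{col}(\mathrm{key}(a)))=\mathrm{col}_R(\mathrm{key}({\rm rev}(a)))$.
   Context: Let $n$ be the length of $a$ and $\mathrm{rev}(a)$ its reversal. $\mathrm{key}(a)$ is the unique key of weight $a$, where a key is a semistandard Young tableau (French notation) in which the entries of column $i+1$ form a subset of the entries of column $i$. For a tableau $T$, $\mathrm{col}(T)$ is the column reading word obtained by reading entries down each column (top to bottom), columns from left to right, and $\mathrm{col}_R(T)$ is the right-to-left column reading word obtained by reading each column top to bottom, starting with the rightmost column and moving leftward. For a word $w$ in $\{1,\ldots,n\}$, $\mathrm{frev}(w)$ is obtained by reversing $w$ and replacing each letter $j$ by $n+1-j$. -}

module Defs where

open import Data.Nat using (ℕ; suc; _∸_; _≤?_; _⊔_)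
open import Data.List using (List; map; reverse; concat; filter; zip; upTo; length; foldr)
open import Data.Product using (_×_; proj₁; proj₂)

WeakComposition : Set
WeakComposition = List ℕ

-- A tableau (French notation) is represented as its list of columns, from left
-- to right; each column lists its entries from BOTTOM to TOP (hence increasing).
Tableau : Set
Tableau = List (List ℕ)

rev : WeakComposition → WeakComposition
rev = reverse

-- column j (j ≥ 1) of key(a): the set { i ∈ {1..n} : aᵢ ≥ j }, listed bottom to top
keyColumn : WeakComposition → ℕ → List ℕ
keyColumn a j = map proj₁ (filter (λ p → j ≤? proj₂ p) (zip (map suc (upTo (length a))) a))

maxPart : WeakComposition → ℕ
maxPart = foldr _⊔_ 0

key : WeakComposition → Tableau
key a = map (keyColumn a) (map suc (upTo (maxPart a)))

col : Tableau → List ℕ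
col T = concat (map reverse T)

colR : Tableau → List ℕ
colR T = concat (map reverse (reverse T))

frev : ℕ → List ℕ → List ℕ
frev n w = map (λ j → suc n ∸ j) (reverse w)

{-# OPTIONS --safe #-}
-- Column j of key(a) is the increasing list of positions i with aᵢ ≥ j, and both
-- key(a) and key(rev(a)) have max a columns.  The reflection i ↦ n+1−i sends position i
-- of a to position n+1−i of rev(a), which carries the same entry, and reverses the order
-- of positions; hence it maps column j of key(a), read bottom to top, onto column j of
-- key(rev(a)) read top to bottom.  Since frev also reverses the order of the columns of
-- the word col(key(a)), the result is the right-to-left column reading of key(rev(a)).

module Submission where

open import Defs
open import Data.List using (length)
open import Relation.Binary.PropositionalEquality using (_≡_)

open import Algebra.Bundles using (CommutativeMonoid)
open import Data.List
  using (List; []; _∷_; _++_; _ʳ++_; [_]; map; reverse; concat; filter; zip; upTo; downFrom; applyUpTo; applyDownFrom)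
open import Data.List.Properties
  using ( map-id; map-∘; map-cong; length-map; concat-map; concat-++; ++-identityʳ; zip-map
        ; unfold-reverse; reverse-++; reverse-involutive; reverse-map; length-reverse
        ; length-upTo; map-upTo; map-downFrom; reverse-upTo)
open import Data.List.Relation.Binary.Permutation.Propositional using (↭⇒↭ₛ)
open import Data.List.Relation.Binary.Permutation.Propositional.Properties using (↭-reverse)
open import Data.List.Relation.Binary.Permutation.Setoid.Properties using (foldr-commMonoid)
open import Data.Bool using (true; false)
open import Data.Nat using (ℕ; zero; suc; _∸_; _≤?_)
open import Data.Nat.Properties using (suc-injective; ⊔-0-commutativeMonoid)
open import Data.Product using (_×_; proj₁; proj₂; map₁)
open import Function using (_∘_; id)
open import Relation.Nullary using (does)
open import Relation.Unary using (Pred; Decidable)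
open import Relation.Binary.PropositionalEquality using (refl; sym; trans; cong; cong₂; module ≡-Reasoning)

open ≡-Reasoning

module _ {a p} {A : Set a} {P : Pred A p} (P? : Decidable P) where

  filter-ʳ++ : ∀ (xs ys : List A) → filter P? (xs ʳ++ ys) ≡ filter P? xs ʳ++ filter P? ys
  filter-ʳ++ []       ys = refl
  filter-ʳ++ (x ∷ xs) ys with ih ← filter-ʳ++ xs (x ∷ ys) | does (P? x)
  ... | true  = ih
  ... | false = ih

  filter-reverse : ∀ (xs : List A) → filter P? (reverse xs) ≡ reverse (filter P? xs)
  filter-reverse xs = filter-ʳ++ xs []

  filter-map : ∀ {b} {B : Set b} (f : B → A) (xs : List B) →
               filter P? (map f xs) ≡ map f (filter (P? ∘ f) xs)
  filter-map f []       = refl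
  filter-map f (x ∷ xs) with ih ← filter-map f xs | does (P? (f x))
  ... | true  = cong (f x ∷_) ih
  ... | false = ih

module _ {a b} {A : Set a} {B : Set b} where

  zip-ʳ++ : ∀ (xs : List A) (ys : List B) → length xs ≡ length ys →
            ∀ us vs → zip (xs ʳ++ us) (ys ʳ++ vs) ≡ zip xs ys ʳ++ zip us vs
  zip-ʳ++ []       []       _  us vs = refl
  zip-ʳ++ (x ∷ xs) (y ∷ ys) eq us vs = zip-ʳ++ xs ys (suc-injective eq) (x ∷ us) (y ∷ vs)

  reverse-zip : ∀ (xs : List A) (ys : List B) → length xs ≡ length ys →
                reverse (zip xs ys) ≡ zip (reverse xs) (reverse ys)
  reverse-zip xs ys eq = sym (zip-ʳ++ xs ys eq [] [])

reverse-concat-map-reverse : ∀ {a} {A : Set a} (xss : List (List A)) →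
                             reverse (concat (map reverse xss)) ≡ concat (reverse xss)
reverse-concat-map-reverse []         = refl
reverse-concat-map-reverse (xs ∷ xss) = begin
  reverse (reverse xs ++ concat (map reverse xss))   ≡⟨ reverse-++ (reverse xs) _ ⟩
  reverse (concat (map reverse xss)) ++ reverse (reverse xs)
    ≡⟨ cong₂ _++_ (reverse-concat-map-reverse xss) (reverse-involutive xs) ⟩
  concat (reverse xss) ++ xs                         ≡⟨ cong (concat (reverse xss) ++_) (++-identityʳ xs) ⟨
  concat (reverse xss) ++ concat [ xs ]              ≡⟨ concat-++ (reverse xss) [ xs ] ⟩
  concat (reverse xss ++ [ xs ])                     ≡⟨ cong concat (unfold-reverse xs xss) ⟨
  concat (reverse (xs ∷ xss))                        ∎

applyUpTo-∸ : ∀ n → applyUpTo (n ∸_) n ≡ applyDownFrom suc n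
applyUpTo-∸ zero    = refl
applyUpTo-∸ (suc n) = cong (suc n ∷_) (applyUpTo-∸ n)

positions : ℕ → List ℕ
positions n = map suc (upTo n)

reflect : ℕ → ℕ → ℕ
reflect n i = suc n ∸ i

map-reflect-positions : ∀ n → map (reflect n) (positions n) ≡ reverse (positions n)
map-reflect-positions n = begin
  map (reflect n) (map suc (upTo n))  ≡⟨ map-∘ (upTo n) ⟨
  map (n ∸_) (upTo n)                 ≡⟨ map-upTo (n ∸_) n ⟩
  applyUpTo (n ∸_) n                  ≡⟨ applyUpTo-∸ n ⟩
  applyDownFrom suc n                 ≡⟨ map-downFrom suc n ⟨
  map suc (downFrom n)                ≡⟨ cong (map suc) (reverse-upTo n) ⟨
  map suc (reverse (upTo n))          ≡⟨ reverse-map suc (upTo n) ⟩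
  reverse (map suc (upTo n))          ∎

indexed : WeakComposition → List (ℕ × ℕ)
indexed a = zip (positions (length a)) a

map-reflect-indexed : ∀ a → map (map₁ (reflect (length a))) (indexed a) ≡ reverse (indexed (rev a))
map-reflect-indexed a = begin
  map (map₁ (reflect n)) (zip (positions n) a)      ≡⟨ zip-map (reflect n) id (positions n) a ⟨
  zip (map (reflect n) (positions n)) (map id a)    ≡⟨ cong₂ zip (map-reflect-positions n) (map-id a) ⟩
  zip (reverse (positions n)) a                     ≡⟨ cong (zip _) (reverse-involutive a) ⟨
  zip (reverse (positions n)) (reverse (reverse a)) ≡⟨ reverse-zip (positions n) (reverse a) equal-lengths ⟨
  reverse (zip (positions n) (reverse a))           ≡⟨ cong (λ m → reverse (zip (positions m) (reverse a))) (length-reverse a) ⟨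
  reverse (indexed (rev a))                         ∎
  where
  n = length a
  equal-lengths : length (positions n) ≡ length (reverse a)
  equal-lengths = trans (length-map suc (upTo n)) (trans (length-upTo n) (sym (length-reverse a)))

map-reflect-keyColumn : ∀ a j → map (reflect (length a)) (keyColumn a j) ≡ reverse (keyColumn (rev a) j)
map-reflect-keyColumn a j = begin
  map F (map proj₁ (filter P? (indexed a)))                 ≡⟨ map-∘ (filter P? (indexed a)) ⟨
  map (proj₁ ∘ map₁ F) (filter P? (indexed a))              ≡⟨ map-∘ (filter P? (indexed a)) ⟩
  map proj₁ (map (map₁ F) (filter P? (indexed a)))          ≡⟨ cong (map proj₁) (filter-map P? (map₁ F) (indexed a)) ⟨
  map proj₁ (filter P? (map (map₁ F) (indexed a)))          ≡⟨ cong (map proj₁ ∘ filter P?) (map-reflect-indexed a) ⟩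
  map proj₁ (filter P? (reverse (indexed (rev a))))         ≡⟨ cong (map proj₁) (filter-reverse P? (indexed (rev a))) ⟩
  map proj₁ (reverse (filter P? (indexed (rev a))))         ≡⟨ reverse-map proj₁ (filter P? (indexed (rev a))) ⟩
  reverse (map proj₁ (filter P? (indexed (rev a))))         ∎
  where
  F = reflect (length a)
  -- P? only inspects the entry, so P? ∘ map₁ F is P? itself and filter-map applies as stated.
  P? = λ (p : ℕ × ℕ) → j ≤? proj₂ p

maxPart-reverse : ∀ a → maxPart (rev a) ≡ maxPart a
maxPart-reverse a = foldr-commMonoid ⊔-0.setoid ⊔-0.isCommutativeMonoid (↭⇒↭ₛ (↭-reverse a))
  where module ⊔-0 = CommutativeMonoid ⊔-0-commutativeMonoid

map-reflect-key : ∀ a → map (map (reflect (length a))) (key a) ≡ map reverse (key (rev a))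
map-reflect-key a = begin
  map (map F) (map (keyColumn a) js)            ≡⟨ map-∘ js ⟨
  map (map F ∘ keyColumn a) js                  ≡⟨ map-cong (map-reflect-keyColumn a) js ⟩
  map (reverse ∘ keyColumn (rev a)) js          ≡⟨ map-∘ js ⟩
  map reverse (map (keyColumn (rev a)) js)      ≡⟨ cong (λ m → map reverse (map (keyColumn (rev a)) (positions m))) (maxPart-reverse a) ⟨
  map reverse (key (rev a))                     ∎
  where
  F = reflect (length a)
  js = positions (maxPart a)

map-reverse-col : ∀ (f : ℕ → ℕ) T → map f (reverse (col T)) ≡ concat (reverse (map (map f) T))
map-reverse-col f T = begin
  map f (reverse (concat (map reverse T)))   ≡⟨ cong (map f) (reverse-concat-map-reverse T) ⟩
  map f (concat (reverse T))                 ≡⟨ concat-map {f = f} (reverse T) ⟨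
  concat (map (map f) (reverse T))           ≡⟨ cong concat (reverse-map (map f) T) ⟩
  concat (reverse (map (map f) T))           ∎

colR-reverse-map : ∀ T → colR T ≡ concat (reverse (map reverse T))
colR-reverse-map T = cong concat (reverse-map reverse T)

mainTheorem18 : (a : WeakComposition) → frev (length a) (col (key a)) ≡ colR (key (rev a))
mainTheorem18 a = begin
  frev (length a) (col (key a))                             ≡⟨ map-reverse-col (reflect (length a)) (key a) ⟩
  concat (reverse (map (map (reflect (length a))) (key a))) ≡⟨ cong (concat ∘ reverse) (map-reflect-key a) ⟩
  concat (reverse (map reverse (key (rev a))))              ≡⟨ colR-reverse-map (key (rev a)) ⟨
  colR (key (rev a))                                        ∎
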